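{- If $n\geq1$, $m>0$ and $(n,m)\neq(1,1)$, then the subgroup $A_{n,m}=\langle\varphi,\psi,\tau\rangle$ of $\mathrm{Aut}(Y_{n,m})$ has order $4n$.
   Context: For integers $n\geq 1$, $m\geq 0$, the Yoke graph $Y_{n,m}$ has vertices the tuples $v=(v_0,\dots,v_{m+1})$ with $v_0,v_{m+1}\in\mathbb{Z}_n$, $v_1,\dots,v_m\in\{0,1\}$ and $\sum_i v_i\equiv0\pmod n$; $u\sim v$ iff for some $0\leq i\leq m$, $u_j=v_j$ for $j\notin\{i,i+1\}$ and $(u_i,u_{i+1})=(v_i\pm1,v_{i+1}\mp1)$, bucket coordinates computed in $\mathbb{Z}_n$ and entries staying in their allowed sets. Automorphisms: $\varphi(v_0,v_1,\dots,v_m,v_{m+1})=(v_0+1,v_1,\dots,v_m,v_{m+1}-1)$; $\psi(v_0,\dots,v_{m+1})=(v_{m+1},v_m,\dots,v_1,v_0)$; $\tau(v_0,v_1,\dots,v_m,v_{m+1})=(-v_0,1-v_1,\dots,1-v_m,-(m+v_{m+1}))$, bucket arithmetic in $\mathbb{Z}_n$. -}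

module Defs where

open import Data.Nat using (ℕ; zero; suc; _+_; _*_; _∸_; _%_; NonZero)
open import Data.Nat.DivMod using (m%n<n)
open import Data.Fin using (Fin; toℕ; fromℕ<)
open import Data.Bool using (Bool; true; false; not)
open import Data.Vec using (Vec; []; _∷_; map; reverse)
open import Data.List using (List; []; _∷_)
open import Data.Product using (_×_; _,_; Σ; ∃)
open import Relation.Binary.PropositionalEquality using (_≡_)

module _ (n : ℕ) .{{_ : NonZero n}} where

  modN : ℕ → Fin n
  modN k = fromℕ< (m%n<n k n)

  _⊕_ : Fin n → Fin n → Fin n
  a ⊕ b = modN (toℕ a + toℕ b)

  ⊖_ : Fin n → Fin n
  ⊖ a = modN (n ∸ toℕ a)

  one : Fin n
  one = modN 1

bit : Bool → ℕ
bit true  = 1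
bit false = 0

bitsum : ∀ {m} → Vec Bool m → ℕ
bitsum []       = 0
bitsum (b ∷ bs) = bit b + bitsum bs

-- raw tuples (v₀, (v₁,…,v_m), v_{m+1})
Tuple : ℕ → ℕ → Set
Tuple n m = Fin n × Vec Bool m × Fin n

IsVertex : (n m : ℕ) .{{_ : NonZero n}} → Tuple n m → Set
IsVertex n m (a , bs , c) = (toℕ a + bitsum bs + toℕ c) % n ≡ 0

module _ (n m : ℕ) .{{_ : NonZero n}} where

  φ : Tuple n m → Tuple n m
  φ (a , bs , c) = _⊕_ n a (one n) , bs , _⊕_ n c (⊖_ n (one n))

  ψ : Tuple n m → Tuple n m
  ψ (a , bs , c) = c , reverse bs , a

  τ : Tuple n m → Tuple n m
  τ (a , bs , c) = ⊖_ n a , map not bs , ⊖_ n (_⊕_ n (modN n m) c)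

data Gen : Set where
  gφ gψ gτ : Gen

-- elements of A_{n,m} are represented by words in the generators
-- (in a finite group the generated subgroup equals the generated monoid)
Word : Set
Word = List Gen

evalGen : (n m : ℕ) .{{_ : NonZero n}} → Gen → Tuple n m → Tuple n m
evalGen n m gφ = φ n m
evalGen n m gψ = ψ n m
evalGen n m gτ = τ n m

eval : (n m : ℕ) .{{_ : NonZero n}} → Word → Tuple n m → Tuple n m
eval n m []      v = v
eval n m (g ∷ w) v = evalGen n m g (eval n m w v)

_≈[_,_]_ : Word → (n m : ℕ) .{{_ : NonZero n}} → Word → Set
w ≈[ n , m ] w' = (v : Tuple n m) → IsVertex n m v → eval n m w v ≡ eval n m w' v

HasOrder : (n m : ℕ) .{{_ : NonZero n}} → ℕ → Set
HasOrder n m k =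
  Σ (Fin k → Word) λ e →
    ((i j : Fin k) → e i ≈[ n , m ] e j → i ≡ j) ×
    ((w : Word) → ∃ λ i → w ≈[ n , m ] e i)

-- Every word in φ, ψ, τ reduces to a normal form φ^k ψ^s τ^t with k ∈ ℤ_n and s, t ∈ {0,1},
-- using φ^n = ψ² = τ² = 1, ψφ = φ⁻¹ψ, τφ = φ⁻¹τ and τψ = φ^m ψτ; hence |A_{n,m}| ≤ 4n.
-- The 4n normal forms are pairwise distinct on vertices: the all-zero vertex detects t through
-- its middle bits and then k through its first bucket, and s is detected by any vertex that ψ
-- moves, such as (0, 1, 0, …, 0, −1); it is fixed by ψ only when n = m = 1.

module Submission where

open import Algebra.Bundles using (AbelianGroup)
open import Algebra.Structures using (IsAbelianGroup)
open import Data.Bool using (Bool; true; false; not; if_then_else_)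
open import Data.Bool.Properties using (not-involutive)
open import Data.Empty using (⊥-elim; ⊥-elim-irr)
open import Data.Fin using (Fin; toℕ) renaming (zero to 0F)
open import Data.Fin.Properties using (toℕ-fromℕ<; toℕ-injective; toℕ<n; *↔×; 2↔Bool)
open import Data.List using ([]; _∷_; _++_)
import Data.List as List
open import Data.Nat using (ℕ; zero; suc; _+_; _*_; _∸_; _%_; _<_; s≤s; NonZero)
open import Data.Nat.DivMod using (%-distribˡ-+; m<n⇒m%n≡m; n%n≡0)
open import Data.Nat.Properties using (+-comm; +-assoc; +-suc; +-identityʳ; m+[n∸m]≡n; <⇒≤)
open import Data.Product using (_×_; _,_; ∃; proj₁; proj₂; uncurry)
open import Data.Product.Function.NonDependent.Propositional using (_×-↔_)
open import Data.Vec using (Vec; []; _∷_; map; reverse; replicate; head; _∷ʳ_)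
open import Data.Vec.Properties
  using (map-replicate; map-reverse; map-const; map-∘; map-cong; map-id; reverse-∷; reverse-involutive)
open import Function using (_∘_; id; const; _↔_; Inverse)
open import Function.Construct.Composition using (_↔-∘_)
open import Function.Properties.Inverse using (↔-refl)
open import Level using (0ℓ)
open import Relation.Binary.PropositionalEquality hiding ([_])
open import Relation.Nullary using (¬_; contradiction)

open import Defs

reverse-replicate : ∀ {A : Set} n (x : A) → reverse (replicate n x) ≡ replicate n x
reverse-replicate n x = begin
  reverse (replicate n x)                   ≡⟨ cong reverse (map-const (replicate n x) x) ⟨
  reverse (map (const x) (replicate n x))   ≡⟨ map-reverse (const x) (replicate n x) ⟨
  map (const x) (reverse (replicate n x))   ≡⟨ map-const _ x ⟩
  replicate n x                             ∎
  where open ≡-Reasoning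

reverse-∷-replicate-fixed : ∀ {A : Set} j {x y : A} → x ≢ y →
                            reverse (x ∷ replicate j y) ≡ x ∷ replicate j y → j ≡ 0
reverse-∷-replicate-fixed zero    _   _     = refl
reverse-∷-replicate-fixed (suc j) {x} {y} x≢y fixed = ⊥-elim (x≢y (begin
  x                                           ≡⟨ cong head fixed ⟨
  head (reverse (x ∷ replicate (suc j) y))    ≡⟨ cong head (reverse-∷ x (replicate (suc j) y)) ⟩
  head (reverse (replicate (suc j) y) ∷ʳ x)   ≡⟨ cong (head ∘ (_∷ʳ x)) (reverse-replicate (suc j) y) ⟩
  y                                           ∎))
  where open ≡-Reasoning

replicate-injective : ∀ {A : Set} {n} {x y : A} → 0 < n → replicate n x ≡ replicate n y → x ≡ y
replicate-injective (s≤s _) = cong head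

map-not-involutive : ∀ {n} (bs : Vec Bool n) → map not (map not bs) ≡ bs
map-not-involutive bs = trans (sym (map-∘ not not bs)) (trans (map-cong not-involutive bs) (map-id bs))

bitsum-replicate-false : ∀ n → bitsum (replicate n false) ≡ 0
bitsum-replicate-false zero    = refl
bitsum-replicate-false (suc n) = bitsum-replicate-false n

bitsum-map-not : ∀ {n} (bs : Vec Bool n) → bitsum (map not bs) + bitsum bs ≡ n
bitsum-map-not []           = refl
bitsum-map-not (true ∷ bs)  = trans (+-suc _ _) (cong suc (bitsum-map-not bs))
bitsum-map-not (false ∷ bs) = cong suc (bitsum-map-not bs)

tuple-≡ : ∀ {A B C : Set} {a a′ : A} {b b′ : B} {c c′ : C} →
          a ≡ a′ → b ≡ b′ → c ≡ c′ → (a , b , c) ≡ (a′ , b′ , c′)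
tuple-≡ refl refl refl = refl

eval-++ : ∀ n m .{{_ : NonZero n}} us ws v → eval n m (us ++ ws) v ≡ eval n m us (eval n m ws v)
eval-++ n m []       ws v = refl
eval-++ n m (g ∷ us) ws v = cong (evalGen n m g) (eval-++ n m us ws v)

hasOrder-fromNormalForms : ∀ {n m} .{{_ : NonZero n}} {k} {Normal : Set}
  (enum : Fin k ↔ Normal) (word : Normal → Word) →
  (∀ x y → word x ≈[ n , m ] word y → x ≡ y) →
  (∀ w → ∃ λ x → w ≈[ n , m ] word x) →
  HasOrder n m k
hasOrder-fromNormalForms {n} {m} enum word word-injective word-complete =
  word ∘ to ,
  (λ i j i≈j → begin
    i             ≡⟨ strictlyInverseʳ i ⟨
    from (to i)   ≡⟨ cong from (word-injective (to i) (to j) i≈j) ⟩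
    from (to j)   ≡⟨ strictlyInverseʳ j ⟩
    j             ∎) ,
  λ w → let (x , w≈x) = word-complete w in
    from x , λ v v-vertex → trans (w≈x v v-vertex) (cong (λ y → eval n m (word y) v) (sym (strictlyInverseˡ x)))
  where
  open Inverse enum
  open ≡-Reasoning

1%[1+n]≡0⇒n≡0 : ∀ n → 1 % suc n ≡ 0 → n ≡ 0
1%[1+n]≡0⇒n≡0 zero    _  = refl
1%[1+n]≡0⇒n≡0 (suc n) ()

module ZMod (n′ : ℕ) where

  N : ℕ
  N = suc n′

  [_] : ℕ → Fin N
  [ k ] = modN N k

  infixl 6 _+ₙ_
  _+ₙ_ : Fin N → Fin N → Fin N
  _+ₙ_ = _⊕_ N

  -ₙ_ : Fin N → Fin N
  -ₙ_ = ⊖_ N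

  0ₙ 1ₙ : Fin N
  0ₙ = 0F
  1ₙ = one N

  open ≡-Reasoning

  toℕ-[] : ∀ k → toℕ [ k ] ≡ k % N
  toℕ-[] k = toℕ-fromℕ< _

  []-toℕ : ∀ a → [ toℕ a ] ≡ a
  []-toℕ a = toℕ-injective (trans (toℕ-[] (toℕ a)) (m<n⇒m%n≡m (toℕ<n a)))

  []-+ : ∀ j k → [ j + k ] ≡ [ j ] +ₙ [ k ]
  []-+ j k = toℕ-injective (begin
    toℕ [ j + k ]                 ≡⟨ toℕ-[] (j + k) ⟩
    (j + k) % N                   ≡⟨ %-distribˡ-+ j k N ⟩
    (j % N + k % N) % N           ≡⟨ cong₂ (λ x y → (x + y) % N) (toℕ-[] j) (toℕ-[] k) ⟨
    (toℕ [ j ] + toℕ [ k ]) % N   ≡⟨ toℕ-[] (toℕ [ j ] + toℕ [ k ]) ⟨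
    toℕ ([ j ] +ₙ [ k ])          ∎)

  +ₙ-assoc : ∀ a b c → (a +ₙ b) +ₙ c ≡ a +ₙ (b +ₙ c)
  +ₙ-assoc a b c = begin
    [ toℕ a + toℕ b ] +ₙ c           ≡⟨ cong ([ toℕ a + toℕ b ] +ₙ_) ([]-toℕ c) ⟨
    [ toℕ a + toℕ b ] +ₙ [ toℕ c ]   ≡⟨ []-+ (toℕ a + toℕ b) (toℕ c) ⟨
    [ toℕ a + toℕ b + toℕ c ]        ≡⟨ cong [_] (+-assoc (toℕ a) (toℕ b) (toℕ c)) ⟩
    [ toℕ a + (toℕ b + toℕ c) ]      ≡⟨ []-+ (toℕ a) (toℕ b + toℕ c) ⟩
    [ toℕ a ] +ₙ (b +ₙ c)            ≡⟨ cong (_+ₙ (b +ₙ c)) ([]-toℕ a) ⟩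
    a +ₙ (b +ₙ c)                    ∎

  +ₙ-comm : ∀ a b → a +ₙ b ≡ b +ₙ a
  +ₙ-comm a b = cong [_] (+-comm (toℕ a) (toℕ b))

  +ₙ-identityʳ : ∀ a → a +ₙ 0ₙ ≡ a
  +ₙ-identityʳ a = trans (cong [_] (+-identityʳ (toℕ a))) ([]-toℕ a)

  +ₙ-inverseʳ : ∀ a → a +ₙ -ₙ a ≡ 0ₙ
  +ₙ-inverseʳ a = begin
    a +ₙ -ₙ a                    ≡⟨ cong (_+ₙ -ₙ a) ([]-toℕ a) ⟨
    [ toℕ a ] +ₙ [ N ∸ toℕ a ]   ≡⟨ []-+ (toℕ a) (N ∸ toℕ a) ⟨
    [ toℕ a + (N ∸ toℕ a) ]      ≡⟨ cong [_] (m+[n∸m]≡n (<⇒≤ (toℕ<n a))) ⟩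
    [ N ]                        ≡⟨ toℕ-injective (trans (toℕ-[] N) (n%n≡0 N)) ⟩
    0ₙ                           ∎

  +ₙ-isAbelianGroup : IsAbelianGroup _≡_ _+ₙ_ 0ₙ -ₙ_
  +ₙ-isAbelianGroup = record
    { isGroup = record
      { isMonoid = record
        { isSemigroup = record
          { isMagma = record { isEquivalence = isEquivalence ; ∙-cong = cong₂ _+ₙ_ }
          ; assoc   = +ₙ-assoc
          }
        ; identity = (λ a → trans (+ₙ-comm 0ₙ a) (+ₙ-identityʳ a)) , +ₙ-identityʳ
        }
      ; inverse = (λ a → trans (+ₙ-comm (-ₙ a) a) (+ₙ-inverseʳ a)) , +ₙ-inverseʳ
      ; ⁻¹-cong = cong -ₙ_
      }
    ; comm = +ₙ-comm
    }

  +ₙ-abelianGroup : AbelianGroup 0ℓ 0ℓ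
  +ₙ-abelianGroup = record { isAbelianGroup = +ₙ-isAbelianGroup }

  open AbelianGroup +ₙ-abelianGroup public
    using () renaming (identityˡ to +ₙ-identityˡ; inverseˡ to +ₙ-inverseˡ)
  open import Algebra.Properties.AbelianGroup +ₙ-abelianGroup public
    using ( ε⁻¹≈ε; ⁻¹-involutive; ⁻¹-injective; ⁻¹-anti-homo-∙; ⁻¹-anti-homo‿-; ⁻¹-∙-comm
          ; xyx⁻¹≈y; inverseˡ-unique )
  open import Algebra.Properties.CommutativeSemigroup (AbelianGroup.commutativeSemigroup +ₙ-abelianGroup) public
    using (interchange; xy∙z≈xz∙y)

  1ₙ≡0ₙ⇒N≡1 : 1ₙ ≡ 0ₙ → N ≡ 1
  1ₙ≡0ₙ⇒N≡1 1≡0 = cong suc (1%[1+n]≡0⇒n≡0 n′ (trans (sym (toℕ-[] 1)) (cong toℕ 1≡0)))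

module Yoke (n′ m : ℕ) where

  open ZMod n′
  open ≡-Reasoning

  V : Set
  V = Tuple N m

  M : Fin N
  M = [ m ]

  shift : Fin N → V → V
  shift k (a , bs , c) = a +ₙ k , bs , c +ₙ -ₙ k

  shift-identity : ∀ v → shift 0ₙ v ≡ v
  shift-identity (a , bs , c) = tuple-≡ (+ₙ-identityʳ a) refl (trans (cong (c +ₙ_) ε⁻¹≈ε) (+ₙ-identityʳ c))

  shift-shift : ∀ j k v → shift j (shift k v) ≡ shift (k +ₙ j) v
  shift-shift j k (a , bs , c) =
    tuple-≡ (+ₙ-assoc a k j) refl (trans (+ₙ-assoc c (-ₙ k) (-ₙ j)) (cong (c +ₙ_) (⁻¹-∙-comm k j)))

  shift-injective : ∀ k {u v} → shift k u ≡ shift k v → u ≡ v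
  shift-injective k {u} {v} e = begin
    u                          ≡⟨ unshift u ⟨
    shift (-ₙ k) (shift k u)   ≡⟨ cong (shift (-ₙ k)) e ⟩
    shift (-ₙ k) (shift k v)   ≡⟨ unshift v ⟩
    v                          ∎
    where
    unshift : ∀ w → shift (-ₙ k) (shift k w) ≡ w
    unshift w = trans (shift-shift (-ₙ k) k w) (trans (cong (λ j → shift j w) (+ₙ-inverseʳ k)) (shift-identity w))

  ψ-shift : ∀ k v → ψ N m (shift k v) ≡ shift (-ₙ k) (ψ N m v)
  ψ-shift k (a , bs , c) = tuple-≡ refl refl (cong (a +ₙ_) (sym (⁻¹-involutive k)))

  ψ-involutive : ∀ v → ψ N m (ψ N m v) ≡ v
  ψ-involutive (a , bs , c) = tuple-≡ refl (reverse-involutive bs) refl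

  τ-shift : ∀ k v → τ N m (shift k v) ≡ shift (-ₙ k) (τ N m v)
  τ-shift k (a , bs , c) = tuple-≡ (sym (⁻¹-∙-comm a k)) refl (begin
    -ₙ (M +ₙ (c +ₙ -ₙ k))    ≡⟨ cong -ₙ_ (+ₙ-assoc M c (-ₙ k)) ⟨
    -ₙ (M +ₙ c +ₙ -ₙ k)      ≡⟨ ⁻¹-∙-comm (M +ₙ c) (-ₙ k) ⟨
    -ₙ (M +ₙ c) +ₙ -ₙ -ₙ k   ∎)

  τ-involutive : ∀ v → τ N m (τ N m v) ≡ v
  τ-involutive (a , bs , c) =
    tuple-≡ (⁻¹-involutive a) (map-not-involutive bs) (trans (⁻¹-anti-homo‿- M (M +ₙ c)) (xyx⁻¹≈y M c))

  τ-ψ : ∀ v → τ N m (ψ N m v) ≡ shift M (ψ N m (τ N m v))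
  τ-ψ (a , bs , c) = tuple-≡ (sym first) (map-reverse not bs) (⁻¹-anti-homo-∙ M a)
    where
    first : -ₙ (M +ₙ c) +ₙ M ≡ -ₙ c
    first = begin
      -ₙ (M +ₙ c) +ₙ M       ≡⟨ +ₙ-comm _ M ⟩
      M +ₙ -ₙ (M +ₙ c)       ≡⟨ ⁻¹-anti-homo‿- (M +ₙ c) M ⟨
      -ₙ (M +ₙ c +ₙ -ₙ M)    ≡⟨ cong -ₙ_ (xyx⁻¹≈y M c) ⟩
      -ₙ c                   ∎

  ψ^ τ^ : Bool → V → V
  ψ^ s = if s then ψ N m else id
  τ^ t = if t then τ N m else id

  τ-τ^ : ∀ t v → τ N m (τ^ t v) ≡ τ^ (not t) v
  τ-τ^ false v = refl
  τ-τ^ true  v = τ-involutive v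

  -- ((s , t) , k) stands for φ^k ψ^s τ^t.
  Normal : Set
  Normal = (Bool × Bool) × Fin N

  ⟦_⟧ : Normal → V → V
  ⟦ (s , t) , k ⟧ = shift k ∘ ψ^ s ∘ τ^ t

  word : Normal → Word
  word ((s , t) , k) =
    List.replicate (toℕ k) gφ ++ (if s then gψ ∷ [] else []) ++ (if t then gτ ∷ [] else [])

  eval-φ^ : ∀ i v → eval N m (List.replicate i gφ) v ≡ shift [ i ] v
  eval-φ^ zero    v = sym (shift-identity v)
  eval-φ^ (suc i) v = begin
    shift 1ₙ (eval N m (List.replicate i gφ) v)   ≡⟨ cong (shift 1ₙ) (eval-φ^ i v) ⟩
    shift 1ₙ (shift [ i ] v)                      ≡⟨ shift-shift 1ₙ [ i ] v ⟩
    shift ([ i ] +ₙ [ 1 ]) v                      ≡⟨ cong (λ k → shift k v) ([]-+ i 1) ⟨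
    shift [ i + 1 ] v                             ≡⟨ cong (λ j → shift [ j ] v) (+-comm i 1) ⟩
    shift [ suc i ] v                             ∎

  eval-if : ∀ b g v → eval N m (if b then g ∷ [] else []) v ≡ (if b then evalGen N m g else id) v
  eval-if false g v = refl
  eval-if true  g v = refl

  eval-word : ∀ x v → eval N m (word x) v ≡ ⟦ x ⟧ v
  eval-word ((s , t) , k) v = begin
    eval N m (φs ++ ψs ++ τs) v                      ≡⟨ eval-++ N m φs (ψs ++ τs) v ⟩
    eval N m φs (eval N m (ψs ++ τs) v)              ≡⟨ eval-φ^ (toℕ k) _ ⟩
    shift [ toℕ k ] (eval N m (ψs ++ τs) v)          ≡⟨ cong₂ shift ([]-toℕ k) (eval-++ N m ψs τs v) ⟩
    shift k (eval N m ψs (eval N m τs v))            ≡⟨ cong (shift k) (eval-if s gψ (eval N m τs v)) ⟩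
    shift k (ψ^ s (eval N m τs v))                   ≡⟨ cong (shift k ∘ ψ^ s) (eval-if t gτ v) ⟩
    ⟦ (s , t) , k ⟧ v                                ∎
    where
    φs = List.replicate (toℕ k) gφ
    ψs = if s then gψ ∷ [] else []
    τs = if t then gτ ∷ [] else []

  act : Gen → Normal → Normal
  act gφ (st , k)               = st , k +ₙ 1ₙ
  act gψ ((s , t) , k)          = (not s , t) , -ₙ k
  act gτ ((false , t) , k)      = (false , not t) , -ₙ k
  act gτ ((true , t) , k)       = (true , not t) , M +ₙ -ₙ k

  act-correct : ∀ g x v → evalGen N m g (⟦ x ⟧ v) ≡ ⟦ act g x ⟧ v
  act-correct gφ ((s , t) , k)     v = shift-shift 1ₙ k (ψ^ s (τ^ t v))
  act-correct gψ ((false , t) , k) v = ψ-shift k (τ^ t v)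
  act-correct gψ ((true , t) , k)  v =
    trans (ψ-shift k (ψ N m (τ^ t v))) (cong (shift (-ₙ k)) (ψ-involutive (τ^ t v)))
  act-correct gτ ((false , t) , k) v = trans (τ-shift k (τ^ t v)) (cong (shift (-ₙ k)) (τ-τ^ t v))
  act-correct gτ ((true , t) , k)  v = begin
    τ N m (shift k (ψ N m u))                   ≡⟨ τ-shift k (ψ N m u) ⟩
    shift (-ₙ k) (τ N m (ψ N m u))              ≡⟨ cong (shift (-ₙ k)) (τ-ψ u) ⟩
    shift (-ₙ k) (shift M (ψ N m (τ N m u)))    ≡⟨ shift-shift (-ₙ k) M (ψ N m (τ N m u)) ⟩
    shift (M +ₙ -ₙ k) (ψ N m (τ N m u))         ≡⟨ cong (shift (M +ₙ -ₙ k) ∘ ψ N m) (τ-τ^ t v) ⟩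
    ⟦ (true , not t) , M +ₙ -ₙ k ⟧ v            ∎
    where
    u = τ^ t v

  normalize : Word → Normal
  normalize []      = (false , false) , 0ₙ
  normalize (g ∷ w) = act g (normalize w)

  eval-normalize : ∀ w v → eval N m w v ≡ ⟦ normalize w ⟧ v
  eval-normalize []      v = sym (shift-identity v)
  eval-normalize (g ∷ w) v = trans (cong (evalGen N m g) (eval-normalize w v)) (act-correct g (normalize w) v)

  word-complete : ∀ w → ∃ λ x → w ≈[ N , m ] word x
  word-complete w = normalize w , λ v _ → trans (eval-normalize w v) (sym (eval-word (normalize w) v))

  weight : V → Fin N
  weight (a , bs , c) = a +ₙ [ bitsum bs ] +ₙ c

  weight-[] : ∀ a bs c → weight (a , bs , c) ≡ [ toℕ a + bitsum bs + toℕ c ]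
  weight-[] a bs c = begin
    a +ₙ [ bitsum bs ] +ₙ c                      ≡⟨ cong₂ (λ x y → x +ₙ [ bitsum bs ] +ₙ y) ([]-toℕ a) ([]-toℕ c) ⟨
    [ toℕ a ] +ₙ [ bitsum bs ] +ₙ [ toℕ c ]      ≡⟨ cong (_+ₙ [ toℕ c ]) ([]-+ (toℕ a) (bitsum bs)) ⟨
    [ toℕ a + bitsum bs ] +ₙ [ toℕ c ]           ≡⟨ []-+ (toℕ a + bitsum bs) (toℕ c) ⟨
    [ toℕ a + bitsum bs + toℕ c ]                ∎

  vertex⇒weight≡0 : ∀ v → IsVertex N m v → weight v ≡ 0ₙ
  vertex⇒weight≡0 (a , bs , c) v-vertex =
    toℕ-injective (trans (cong toℕ (weight-[] a bs c)) (trans (toℕ-[] (toℕ a + bitsum bs + toℕ c)) v-vertex))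

  weight≡0⇒vertex : ∀ v → weight v ≡ 0ₙ → IsVertex N m v
  weight≡0⇒vertex (a , bs , c) weight≡0 =
    trans (sym (toℕ-[] (toℕ a + bitsum bs + toℕ c))) (trans (cong toℕ (sym (weight-[] a bs c))) (cong toℕ weight≡0))

  weight-τ : ∀ v → weight (τ N m v) +ₙ weight v ≡ 0ₙ
  weight-τ (a , bs , c) = begin
    (-ₙ a +ₙ [ B′ ] +ₙ -ₙ (M +ₙ c)) +ₙ (a +ₙ [ B ] +ₙ c)
      ≡⟨ interchange (-ₙ a +ₙ [ B′ ]) (-ₙ (M +ₙ c)) (a +ₙ [ B ]) c ⟩
    (-ₙ a +ₙ [ B′ ]) +ₙ (a +ₙ [ B ]) +ₙ (-ₙ (M +ₙ c) +ₙ c)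
      ≡⟨ cong (_+ₙ (-ₙ (M +ₙ c) +ₙ c)) (interchange (-ₙ a) [ B′ ] a [ B ]) ⟩
    (-ₙ a +ₙ a) +ₙ ([ B′ ] +ₙ [ B ]) +ₙ (-ₙ (M +ₙ c) +ₙ c)
      ≡⟨ cong₂ (λ x y → x +ₙ y +ₙ (-ₙ (M +ₙ c) +ₙ c)) (+ₙ-inverseˡ a) (sym ([]-+ B′ B)) ⟩
    0ₙ +ₙ [ B′ + B ] +ₙ (-ₙ (M +ₙ c) +ₙ c)
      ≡⟨ cong (_+ₙ (-ₙ (M +ₙ c) +ₙ c)) (trans (+ₙ-identityˡ [ B′ + B ]) (cong [_] (bitsum-map-not bs))) ⟩
    M +ₙ (-ₙ (M +ₙ c) +ₙ c)                                ≡⟨ +ₙ-assoc M (-ₙ (M +ₙ c)) c ⟨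
    M +ₙ -ₙ (M +ₙ c) +ₙ c                                  ≡⟨ xy∙z≈xz∙y M (-ₙ (M +ₙ c)) c ⟩
    M +ₙ c +ₙ -ₙ (M +ₙ c)                                  ≡⟨ +ₙ-inverseʳ (M +ₙ c) ⟩
    0ₙ                                                     ∎
    where
    B  = bitsum bs
    B′ = bitsum (map not bs)

  τ-vertex : ∀ v → IsVertex N m v → IsVertex N m (τ N m v)
  τ-vertex v v-vertex = weight≡0⇒vertex (τ N m v) (begin
    weight (τ N m v)    ≡⟨ inverseˡ-unique (weight (τ N m v)) (weight v) (weight-τ v) ⟩
    -ₙ weight v         ≡⟨ cong -ₙ_ (vertex⇒weight≡0 v v-vertex) ⟩
    -ₙ 0ₙ               ≡⟨ ε⁻¹≈ε ⟩
    0ₙ                  ∎)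

  origin : V
  origin = 0ₙ , replicate m false , 0ₙ

  origin-vertex : IsVertex N m origin
  origin-vertex = cong (λ b → (b + 0) % N) (bitsum-replicate-false m)

  bits : V → Vec Bool m
  bits = proj₁ ∘ proj₂

  bits-⟦⟧-origin : ∀ s t k → bits (⟦ (s , t) , k ⟧ origin) ≡ replicate m t
  bits-⟦⟧-origin false false k = refl
  bits-⟦⟧-origin false true  k = map-replicate not false m
  bits-⟦⟧-origin true  false k = reverse-replicate m false
  bits-⟦⟧-origin true  true  k = trans (cong reverse (map-replicate not false m)) (reverse-replicate m true)

  proj₁-⟦⟧-origin : ∀ s k → proj₁ (⟦ (s , false) , k ⟧ origin) ≡ k
  proj₁-⟦⟧-origin false k = +ₙ-identityˡ k
  proj₁-⟦⟧-origin true  k = +ₙ-identityˡ k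

  Agree : Normal → Normal → Set
  Agree x y = ∀ v → IsVertex N m v → ⟦ x ⟧ v ≡ ⟦ y ⟧ v

  untwist : ∀ s s′ k k′ → Agree ((s , true) , k) ((s′ , true) , k′) →
                          Agree ((s , false) , k) ((s′ , false) , k′)
  untwist s s′ k k′ agree v v-vertex =
    subst (λ u → ⟦ (s , false) , k ⟧ u ≡ ⟦ (s′ , false) , k′ ⟧ u) (τ-involutive v)
          (agree (τ N m v) (τ-vertex v v-vertex))

  module Separation (0<m : 0 < m) (w : V) (w-vertex : IsVertex N m w) (ψw≢w : ψ N m w ≢ w) where

    twist-determined : ∀ s s′ t t′ k k′ → Agree ((s , t) , k) ((s′ , t′) , k′) → t ≡ t′
    twist-determined s s′ t t′ k k′ agree = replicate-injective 0<m (begin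
      replicate m t                     ≡⟨ bits-⟦⟧-origin s t k ⟨
      bits (⟦ (s , t) , k ⟧ origin)     ≡⟨ cong bits (agree origin origin-vertex) ⟩
      bits (⟦ (s′ , t′) , k′ ⟧ origin)  ≡⟨ bits-⟦⟧-origin s′ t′ k′ ⟩
      replicate m t′                    ∎)

    flip-determined : ∀ s s′ → ψ^ s w ≡ ψ^ s′ w → s ≡ s′
    flip-determined false false _   = refl
    flip-determined true  true  _   = refl
    flip-determined false true  w≡ψw = ⊥-elim (ψw≢w (sym w≡ψw))
    flip-determined true  false ψw≡w = ⊥-elim (ψw≢w ψw≡w)

    untwisted-injective : ∀ s s′ k k′ → Agree ((s , false) , k) ((s′ , false) , k′) → s ≡ s′ × k ≡ k′
    untwisted-injective s s′ k k′ agree = flip-determined s s′ (shift-injective k same-shift) , k≡k′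
      where
      k≡k′ : k ≡ k′
      k≡k′ = begin
        k                                       ≡⟨ proj₁-⟦⟧-origin s k ⟨
        proj₁ (⟦ (s , false) , k ⟧ origin)      ≡⟨ cong proj₁ (agree origin origin-vertex) ⟩
        proj₁ (⟦ (s′ , false) , k′ ⟧ origin)    ≡⟨ proj₁-⟦⟧-origin s′ k′ ⟩
        k′                                      ∎
      same-shift : ⟦ (s , false) , k ⟧ w ≡ ⟦ (s′ , false) , k ⟧ w
      same-shift = trans (agree w w-vertex) (cong (λ j → ⟦ (s′ , false) , j ⟧ w) (sym k≡k′))

    ⟦⟧-injective : ∀ x y → Agree x y → x ≡ y
    ⟦⟧-injective ((s , false) , k) ((s′ , false) , k′) agree =
      uncurry (cong₂ (λ s k → (s , false) , k)) (untwisted-injective s s′ k k′ agree)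
    ⟦⟧-injective ((s , true)  , k) ((s′ , true)  , k′) agree =
      uncurry (cong₂ (λ s k → (s , true) , k)) (untwisted-injective s s′ k k′ (untwist s s′ k k′ agree))
    ⟦⟧-injective ((s , false) , k) ((s′ , true)  , k′) agree =
      contradiction (twist-determined s s′ false true k k′ agree) λ ()
    ⟦⟧-injective ((s , true)  , k) ((s′ , false) , k′) agree =
      contradiction (twist-determined s s′ true false k k′ agree) λ ()

    word-injective : ∀ x y → word x ≈[ N , m ] word y → x ≡ y
    word-injective x y x≈y =
      ⟦⟧-injective x y (λ v v-vertex → trans (sym (eval-word x v)) (trans (x≈y v v-vertex) (eval-word y v)))

  enumeration : Fin (4 * N) ↔ Normal
  enumeration = ((2↔Bool ×-↔ 2↔Bool) ↔-∘ *↔× {2} {2} ×-↔ ↔-refl) ↔-∘ *↔× {4} {N}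

  hasOrder : 0 < m → (∃ λ w → IsVertex N m w × ψ N m w ≢ w) → HasOrder N m (4 * N)
  hasOrder 0<m (w , w-vertex , ψw≢w) =
    hasOrder-fromNormalForms enumeration word (Separation.word-injective 0<m w w-vertex ψw≢w) word-complete

asymmetric-vertex : ∀ n′ m′ → ¬ (suc n′ ≡ 1 × suc m′ ≡ 1) →
                    ∃ λ w → IsVertex (suc n′) (suc m′) w × ψ (suc n′) (suc m′) w ≢ w
asymmetric-vertex n′ m′ ¬n≡1×m≡1 = w , weight≡0⇒vertex w w-weight , ψw≢w
  where
  open ZMod n′
  open Yoke n′ (suc m′)

  w : V
  w = 0ₙ , true ∷ replicate m′ false , -ₙ 1ₙ

  w-weight : weight w ≡ 0ₙ
  w-weight = begin
    0ₙ +ₙ [ suc (bitsum (replicate m′ false)) ] +ₙ -ₙ 1ₙ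
      ≡⟨ cong (λ b → 0ₙ +ₙ [ suc b ] +ₙ -ₙ 1ₙ) (bitsum-replicate-false m′) ⟩
    0ₙ +ₙ 1ₙ +ₙ -ₙ 1ₙ                                      ≡⟨ cong (_+ₙ -ₙ 1ₙ) (+ₙ-identityˡ 1ₙ) ⟩
    1ₙ +ₙ -ₙ 1ₙ                                            ≡⟨ +ₙ-inverseʳ 1ₙ ⟩
    0ₙ                                                     ∎
    where open ≡-Reasoning

  ψw≢w : ψ (suc n′) (suc m′) w ≢ w
  ψw≢w ψw≡w = ¬n≡1×m≡1 (1ₙ≡0ₙ⇒N≡1 (⁻¹-injective (trans (cong proj₁ ψw≡w) (sym ε⁻¹≈ε))) ,
                        cong suc (reverse-∷-replicate-fixed m′ (λ ()) (cong bits ψw≡w)))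

lemma6p11 : (n m : ℕ) .{{_ : NonZero n}} → 0 < m → ¬ (n ≡ 1 × m ≡ 1) →
    HasOrder n m (4 * n)
lemma6p11 zero     m        {{n≢0}} _   _         = ⊥-elim-irr (NonZero.nonZero n≢0)
lemma6p11 (suc n′) zero     ()
lemma6p11 (suc n′) (suc m′) 0<m ¬n≡1×m≡1 =
  Yoke.hasOrder n′ (suc m′) 0<m (asymmetric-vertex n′ m′ ¬n≡1×m≡1)
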